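{- For every $\varphi\in\mathcal{L}_{AIL}$, the canonical model $M^*$ for $\Phi=cl(\varphi)$ is an epistemic model with awareness.
   Context: $\mathcal{P}$ is a countable set of atoms, $\mathcal{G}$ a finite set of agents; $\mathcal{L}_{AIL}$ is generated by $\varphi::= p\mid\neg\varphi\mid\varphi\wedge\varphi\mid A_i\varphi\mid I_i\varphi\mid E_i\varphi\mid[\approx]_i\varphi\mid[\circ^+]_i\varphi$. An epistemic model with awareness is $\langle W,\{\sim_i,\mathscr{A}_i\}_{i\in\mathcal{G}},V\rangle$ with $W\neq\emptyset$, each $\sim_i$ an equivalence relation on $W$, each $\mathscr{A}_i:W\to2^{\mathcal{P}}$ such that $(w,v)\in\sim_i$ implies $\mathscr{A}_i(w)=\mathscr{A}_i(v)$, and $V:\mathcal{P}\to2^W$. Closure: $cl(\varphi)$ is the smallest set such that (1) $\varphi\in cl(\varphi)$; (2) it is closed under subformulae; (3) if $\psi\in cl(\varphi)$ is not a negation then $\neg\psi\in cl(\varphi)$; (4) if $A_i\psi\in cl(\varphi)$ then $A_i\chi\in cl(\varphi)$ for every subformula $\chi$ of $\psi$; (5) if $A_i\psi\in cl(\varphi)$ then $I_iA_i\psi$, $I_i\neg A_i\psi$, and $[\approx]_ip$ for every atom $p$ occurring in $\psi$, are in $cl(\varphi)$; (6) if $I_i\psi\in cl(\varphi)$ and $\psi$ is of neither form $I_i\chi$ nor $\neg I_i\chi$, then $I_iI_i\psi,I_i\neg I_i\psi\in cl(\varphi)$; (7) likewise with $[\approx]_i$ in place of $I_i$; (8) if $[\circ^+]_i\psi\in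 cl(\varphi)$ then $[\approx]_iI_i[\circ^+]_i\psi\in cl(\varphi)$; (9) if $E_i\psi\in cl(\varphi)$ then $A_i\psi,[\circ^+]_i\psi\in cl(\varphi)$. $\mathbf{AIL}$ is the smallest set of formulae containing all instances (for $i,j\in\mathcal{G}$, atoms $p$) of: propositional tautologies; $A_i\varphi\leftrightarrow A_i\neg\varphi$; $A_i(\varphi\wedge\psi)\leftrightarrow A_i\varphi\wedge A_i\psi$; $A_i\varphi\leftrightarrow A_iO_j\varphi$ for each $O\in\{A,I,[\approx],[\circ^+],E\}$; $A_i\varphi\to I_iA_i\varphi$; $\neg A_i\varphi\to I_i\neg A_i\varphi$; $A_ip\wedge p\to[\approx]_ip$; for $\Box\in\{I_i,[\approx]_i\}$: $\Box(\varphi\to\psi)\to(\Box\varphi\to\Box\psi)$, $\Box\varphi\to\varphi$, $\neg\Box\varphi\to\Box\neg\Box\varphi$; $[\circ^+]_i(\varphi\to\psi)\to([\circ^+]_i\varphi\to[\circ^+]_i\psi)$; $[\circ^+]_i\varphi\to\varphi\wedge[\approx]_iI_i[\circ^+]_i\varphi$; $[\circ^+]_i(\varphi\to[\approx]_iI_i\varphi)\to(\varphi\to[\circ^+]_i\varphi)$; $E_i\varphi\leftrightarrow A_i\varphi\wedge[\circ^+]_i\varphi$; closed under Modus Ponens and necessitation for $I_i$, $[\approx]_i$, $[\circ^+]_i$. $\vdash\varphi$ iff $\varphi\in\mathbf{AIL}$; $\Gamma\vdash\varphi$ iff $\vdash\bigwedge\Gamma'\to\varphi$ for some finite $\Gamma'\subseteq\Gamma$.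 $\Gamma$ is a consistent set in $\Phi$ iff $\Gamma\subseteq\Phi$ and $\Gamma\nvdash\bot$; a maximal consistent set in $\Phi$ is a consistent set in $\Phi$ with no proper superset $\Gamma'\subseteq\Phi$ that is consistent. The canonical model for $\Phi$ is $M^*=\langle W^*,\{\sim_i^*,\mathscr{A}_i^*\}_{i\in\mathcal{G}},V^*\rangle$ with $W^*$ the set of maximal consistent sets in $\Phi$; $(\Gamma,\Delta)\in\sim_i^*$ iff $\{\psi\mid I_i\psi\in\Gamma\}\subseteq\Delta$; $V^*(p)=\{\Gamma\mid p\in\Gamma\}$; $\mathscr{A}_i^*(\Gamma)=\{p\in\mathcal{P}\mid A_ip\in\Gamma\}$. -}

module Defs where

open import Level using (Level; _⊔_; 0ℓ) renaming (suc to lsuc)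
open import Data.Nat using (ℕ; zero)
open import Data.Fin using (Fin)
open import Data.Bool using (Bool; true; false; not; _∧_)
open import Data.List using (List; []; _∷_; foldr)
open import Data.List.Relation.Unary.All using (All)
open import Data.Product using (Σ; ∃; _×_; _,_)
open import Relation.Nullary using (¬_)
open import Relation.Unary using (Pred; _⊆_)
open import Relation.Binary using (Rel; IsEquivalence)
open import Relation.Binary.PropositionalEquality using (_≡_)

module _ {n : ℕ} where

  Agent : Set
  Agent = Fin n

  infixr 6 _∧'_
  data Form : Set where
    atom : ℕ → Form
    ¬'_  : Form → Form
    _∧'_ : Form → Form → Form
    A    : Agent → Form → Form
    I    : Agent → Form → Form
    E    : Agent → Form → Form
    [≈]  : Agent → Form → Form
    [∘+] : Agent → Form → Form

  ⊥' : Form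
  ⊥' = atom zero ∧' ¬' atom zero

  ⊤' : Form
  ⊤' = ¬' ⊥'

  infixr 4 _⇒_
  _⇒_ : Form → Form → Form
  φ ⇒ ψ = ¬' (φ ∧' ¬' ψ)

  _⇔_ : Form → Form → Form
  φ ⇔ ψ = (φ ⇒ ψ) ∧' (ψ ⇒ φ)

  ⋀ : List Form → Form
  ⋀ = foldr _∧'_ ⊤'

  -- Propositional tautologies: formulas true under every Boolean valuation
  -- that treats atoms and modal formulas as propositional variables.
  eval : (Form → Bool) → Form → Bool
  eval v (¬' φ) = not (eval v φ)
  eval v (φ ∧' ψ) = eval v φ ∧ eval v ψ
  eval v φ = v φ

  Tautology : Form → Set
  Tautology φ = ∀ (v : Form → Bool) → eval v φ ≡ true

  data Sub : Form → Form → Set where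
    here  : ∀ {φ} → Sub φ φ
    ¬-s   : ∀ {χ φ} → Sub χ φ → Sub χ (¬' φ)
    ∧-l   : ∀ {χ φ ψ} → Sub χ φ → Sub χ (φ ∧' ψ)
    ∧-r   : ∀ {χ φ ψ} → Sub χ ψ → Sub χ (φ ∧' ψ)
    A-s   : ∀ {χ i φ} → Sub χ φ → Sub χ (A i φ)
    I-s   : ∀ {χ i φ} → Sub χ φ → Sub χ (I i φ)
    E-s   : ∀ {χ i φ} → Sub χ φ → Sub χ (E i φ)
    ≈-s   : ∀ {χ i φ} → Sub χ φ → Sub χ ([≈] i φ)
    ∘-s   : ∀ {χ i φ} → Sub χ φ → Sub χ ([∘+] i φ)

  IsNeg : Form → Set
  IsNeg ψ = ∃ λ χ → ψ ≡ ¬' χ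

  OfForm : (Form → Form) → Form → Set
  OfForm O ψ = ∃ λ χ → (ψ ≡ O χ) ⊎' (ψ ≡ ¬' (O χ))
    where
      open import Data.Sum using () renaming (_⊎_ to _⊎'_)

  data Cl (φ : Form) : Form → Set where
    c1  : Cl φ φ
    c2  : ∀ {ψ χ} → Cl φ ψ → Sub χ ψ → Cl φ χ
    c3  : ∀ {ψ} → Cl φ ψ → ¬ IsNeg ψ → Cl φ (¬' ψ)
    c4  : ∀ {i ψ χ} → Cl φ (A i ψ) → Sub χ ψ → Cl φ (A i χ)
    c5a : ∀ {i ψ} → Cl φ (A i ψ) → Cl φ (I i (A i ψ))
    c5b : ∀ {i ψ} → Cl φ (A i ψ) → Cl φ (I i (¬' A i ψ))
    c5c : ∀ {i ψ p} → Cl φ (A i ψ) → Sub (atom p) ψ → Cl φ ([≈] i (atom p))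
    c6a : ∀ {i ψ} → Cl φ (I i ψ) → ¬ OfForm (I i) ψ → Cl φ (I i (I i ψ))
    c6b : ∀ {i ψ} → Cl φ (I i ψ) → ¬ OfForm (I i) ψ → Cl φ (I i (¬' I i ψ))
    c7a : ∀ {i ψ} → Cl φ ([≈] i ψ) → ¬ OfForm ([≈] i) ψ → Cl φ ([≈] i ([≈] i ψ))
    c7b : ∀ {i ψ} → Cl φ ([≈] i ψ) → ¬ OfForm ([≈] i) ψ → Cl φ ([≈] i (¬' [≈] i ψ))
    c8  : ∀ {i ψ} → Cl φ ([∘+] i ψ) → Cl φ ([≈] i (I i ([∘+] i ψ)))
    c9a : ∀ {i ψ} → Cl φ (E i ψ) → Cl φ (A i ψ)
    c9b : ∀ {i ψ} → Cl φ (E i ψ) → Cl φ ([∘+] i ψ)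

  data Axiom : Form → Set where
    taut    : ∀ {φ} → Tautology φ → Axiom φ
    A¬      : ∀ {i φ} → Axiom (A i φ ⇔ A i (¬' φ))
    A∧      : ∀ {i φ ψ} → Axiom (A i (φ ∧' ψ) ⇔ (A i φ ∧' A i ψ))
    AA      : ∀ {i j φ} → Axiom (A i φ ⇔ A i (A j φ))
    AI      : ∀ {i j φ} → Axiom (A i φ ⇔ A i (I j φ))
    A≈      : ∀ {i j φ} → Axiom (A i φ ⇔ A i ([≈] j φ))
    A∘      : ∀ {i j φ} → Axiom (A i φ ⇔ A i ([∘+] j φ))
    AE      : ∀ {i j φ} → Axiom (A i φ ⇔ A i (E j φ))
    A-intro : ∀ {i φ} → Axiom (A i φ ⇒ I i (A i φ))
    ¬A-intro : ∀ {i φ} → Axiom (¬' A i φ ⇒ I i (¬' A i φ))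
    A≈p     : ∀ {i p} → Axiom ((A i (atom p) ∧' atom p) ⇒ [≈] i (atom p))
    KI      : ∀ {i φ ψ} → Axiom (I i (φ ⇒ ψ) ⇒ (I i φ ⇒ I i ψ))
    TI      : ∀ {i φ} → Axiom (I i φ ⇒ φ)
    5I      : ∀ {i φ} → Axiom (¬' I i φ ⇒ I i (¬' I i φ))
    K≈      : ∀ {i φ ψ} → Axiom ([≈] i (φ ⇒ ψ) ⇒ ([≈] i φ ⇒ [≈] i ψ))
    T≈      : ∀ {i φ} → Axiom ([≈] i φ ⇒ φ)
    5≈      : ∀ {i φ} → Axiom (¬' [≈] i φ ⇒ [≈] i (¬' [≈] i φ))
    K∘      : ∀ {i φ ψ} → Axiom ([∘+] i (φ ⇒ ψ) ⇒ ([∘+] i φ ⇒ [∘+] i ψ))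
    Mix∘    : ∀ {i φ} → Axiom ([∘+] i φ ⇒ (φ ∧' [≈] i (I i ([∘+] i φ))))
    Ind∘    : ∀ {i φ} → Axiom ([∘+] i (φ ⇒ [≈] i (I i φ)) ⇒ (φ ⇒ [∘+] i φ))
    Edef    : ∀ {i φ} → Axiom (E i φ ⇔ (A i φ ∧' [∘+] i φ))

  data ⊢_ : Form → Set where
    ax    : ∀ {φ} → Axiom φ → ⊢ φ
    mp    : ∀ {φ ψ} → ⊢ (φ ⇒ ψ) → ⊢ φ → ⊢ ψ
    nec-I : ∀ {i φ} → ⊢ φ → ⊢ I i φ
    nec-≈ : ∀ {i φ} → ⊢ φ → ⊢ [≈] i φ
    nec-∘ : ∀ {i φ} → ⊢ φ → ⊢ [∘+] i φ

  _⊢'_ : Pred Form 0ℓ → Form → Set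
  Γ ⊢' φ = Σ (List Form) λ Γ' → All Γ Γ' × (⊢ (⋀ Γ' ⇒ φ))

  ConsistentIn : (Φ Γ : Pred Form 0ℓ) → Set
  ConsistentIn Φ Γ = (Γ ⊆ Φ) × ¬ (Γ ⊢' ⊥')

  MaxConsistentIn : (Φ Γ : Pred Form 0ℓ) → Set₁
  MaxConsistentIn Φ Γ =
    ConsistentIn Φ Γ × (∀ (Γ' : Pred Form 0ℓ) → Γ ⊆ Γ' → ConsistentIn Φ Γ' → Γ' ⊆ Γ)

  -- Awareness sets are subsets of 𝒫 = ℕ given as predicates; equality of
  -- awareness sets is extensional equality of predicates.
  record IsEpistemicModelWithAwareness {a ℓ : Level}
      (W : Set a) (R : Agent → Rel W ℓ) (Aw : Agent → W → Pred ℕ ℓ)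
      (V : ℕ → Pred W ℓ) : Set (a ⊔ lsuc ℓ) where
    field
      nonempty : W
      equiv    : ∀ i → IsEquivalence (R i)
      aw-inv   : ∀ i {w v} → R i w v → ∀ p → (Aw i w p → Aw i v p) × (Aw i v p → Aw i w p)

  W* : Pred Form 0ℓ → Set₁
  W* Φ = Σ (Pred Form 0ℓ) (MaxConsistentIn Φ)

  ∼* : (Φ : Pred Form 0ℓ) → Agent → Rel (W* Φ) 0ℓ
  ∼* Φ i (Γ , _) (Δ , _) = ∀ ψ → Γ (I i ψ) → Δ ψ

  𝒜* : (Φ : Pred Form 0ℓ) → Agent → W* Φ → Pred ℕ 0ℓ
  𝒜* Φ i (Γ , _) p = Γ (A i (atom p))

  V* : (Φ : Pred Form 0ℓ) → ℕ → Pred (W* Φ) 0ℓ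
  V* Φ p (Γ , _) = Γ (atom p)

{-# OPTIONS --safe #-}
module Submission where

open import Data.Bool using (Bool; true; false; not; _∧_; T)
open import Data.Bool.Properties using (T-≡; T-∧)
open import Data.Empty using (⊥-elim)
open import Data.Fin using (_≟_)
open import Data.List using (List; []; _∷_; _++_)
open import Data.List.Relation.Unary.All using (All; []; _∷_)
open import Data.List.Relation.Unary.All.Properties using (++⁺)
open import Data.Nat using (ℕ)
open import Data.Product using (Σ-syntax; _×_; _,_; proj₁; proj₂)
open import Data.Sum using (inj₁; inj₂)
open import Function using (_∘_; id; flip; Equivalence)
open import Level using (0ℓ)
open import Relation.Binary using (IsEquivalence)
open import Relation.Binary.PropositionalEquality using (_≡_; refl; cong; cong₂; subst)
open import Relation.Nullary using (¬_; Dec; yes; no)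
open import Relation.Nullary.Decidable using (T?; decidable-stable)
open import Relation.Unary using (Pred; Decidable; _⊆_; _∪_; _∩_; ｛_｝)

open import Defs

open Equivalence using (to; from)

-- Lindenbaum's lemma is not available constructively, so a world of the canonical model is
-- exhibited directly: erasing the modalities (A_i χ becomes ⊤, the other operators vanish)
-- computes truth in a one-world model with full awareness, which validates AIL; hence, under
-- any valuation, the formulas of Φ with a true erasure form a maximal consistent set in Φ.
-- Reflexivity of ∼ᵢ* is axiom T. For symmetry and transitivity, related worlds agree on every
-- I_i χ ∈ Φ: introspection (4 and 5, with closure clause (6) keeping I_i I_i χ and I_i ¬I_i χ
-- inside Φ) carries I_i χ and ¬I_i χ along ∼ᵢ*; when χ is itself I_i θ or ¬I_i θ, T, 4 and 5
-- reduce the claim to θ. Awareness is invariant by A_i p → I_i A_i p and symmetry.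

T-not⁺ : ∀ x → ¬ T x → T (not x)
T-not⁺ false _ = _
T-not⁺ true ¬t = ¬t _

T-not⁻ : ∀ x → T (not x) → ¬ T x
T-not⁻ false _ ()

module _ {n : ℕ} where

  private variable
    a b c : Form {n}
    i : Agent {n}
    Φ Γ : Pred (Form {n}) 0ℓ

  -- A record rather than T (eval v φ), so that φ can be inferred from the type v ⊨ φ.
  infix 3.5 _⊨_
  record _⊨_ (v : Form {n} → Bool) (φ : Form {n}) : Set where
    constructor ⟨_⟩
    field truth : T (eval v φ)
  open _⊨_

  module _ {v : Form {n} → Bool} where

    ¬⁺ : ¬ v ⊨ a → v ⊨ ¬' a
    ¬⁺ {a} ¬h = ⟨ T-not⁺ (eval v a) (¬h ∘ ⟨_⟩) ⟩

    ¬⁻ : v ⊨ ¬' a → ¬ v ⊨ a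
    ¬⁻ {a} h = T-not⁻ (eval v a) (truth h) ∘ truth

    ∧⁺ : v ⊨ a → v ⊨ b → v ⊨ a ∧' b
    ∧⁺ ha hb = ⟨ from T-∧ (truth ha , truth hb) ⟩

    ∧⁻ˡ : v ⊨ a ∧' b → v ⊨ a
    ∧⁻ˡ h = ⟨ proj₁ (to T-∧ (truth h)) ⟩

    ∧⁻ʳ : v ⊨ a ∧' b → v ⊨ b
    ∧⁻ʳ h = ⟨ proj₂ (to T-∧ (truth h)) ⟩

    ⊨-stable : ¬ ¬ v ⊨ a → v ⊨ a
    ⊨-stable {a} ¬¬h = ⟨ decidable-stable (T? (eval v a)) (λ ¬t → ¬¬h (¬t ∘ truth)) ⟩

    ⇒⁺ : (v ⊨ a → v ⊨ b) → v ⊨ (a ⇒ b)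
    ⇒⁺ f = ¬⁺ λ h → ¬⁻ (∧⁻ʳ h) (f (∧⁻ˡ h))

    ⇒⁻ : v ⊨ (a ⇒ b) → v ⊨ a → v ⊨ b
    ⇒⁻ h ha = ⊨-stable λ ¬hb → ¬⁻ h (∧⁺ ha (¬⁺ ¬hb))

    ⊤⁺ : v ⊨ ⊤'
    ⊤⁺ = ¬⁺ λ h → ¬⁻ (∧⁻ʳ h) (∧⁻ˡ h)

    ⊥⁻ : ¬ v ⊨ ⊥'
    ⊥⁻ = ¬⁻ ⊤⁺

    ⋀-++ : ∀ L₁ {L₂} → v ⊨ ⋀ (L₁ ++ L₂) → v ⊨ ⋀ L₁ × v ⊨ ⋀ L₂
    ⋀-++ [] h = ⊤⁺ , h
    ⋀-++ (_ ∷ L₁) h with ⋀-++ L₁ (∧⁻ʳ h)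
    ... | h₁ , h₂ = ∧⁺ (∧⁻ˡ h) h₁ , h₂

  ⊢-taut : (∀ v → v ⊨ a) → ⊢ a
  ⊢-taut f = ax (taut λ v → to T-≡ (truth (f v)))

  ⊢-by : ⊢ a → (∀ v → v ⊨ a → v ⊨ b) → ⊢ b
  ⊢-by p f = mp (⊢-taut λ v → ⇒⁺ (f v)) p

  ⊢-by₂ : ⊢ a → ⊢ b → (∀ v → v ⊨ a → v ⊨ b → v ⊨ c) → ⊢ c
  ⊢-by₂ p q f = mp (⊢-by p λ v ha → ⇒⁺ (f v ha)) q

  ⊢I⇒II : ⊢ (I i a ⇒ I i (I i a))
  ⊢I⇒II {i} {a} = ⊢-by₂ I⇒I¬I¬I I¬I¬I⇒II λ _ h₁ h₂ → ⇒⁺ (⇒⁻ h₂ ∘ ⇒⁻ h₁)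
    where
    I⇒I¬I¬I : ⊢ (I i a ⇒ I i (¬' I i (¬' I i a)))
    I⇒I¬I¬I = ⊢-by₂ (ax TI) (ax 5I) λ _ t 5¬ → ⇒⁺ λ h → ⇒⁻ 5¬ (¬⁺ λ h¬ → ¬⁻ (⇒⁻ t h¬) h)

    I¬I¬I⇒II : ⊢ (I i (¬' I i (¬' I i a)) ⇒ I i (I i a))
    I¬I¬I⇒II = mp (ax KI) (nec-I (⊢-by (ax 5I) λ _ 5a → ⇒⁺ λ h → ⊨-stable (¬⁻ h ∘ ⇒⁻ 5a ∘ ¬⁺)))

  ⊢'-∈ : Γ a → Γ ⊢' a
  ⊢'-∈ γ = _ ∷ [] , γ ∷ [] , ⊢-taut λ _ → ⇒⁺ ∧⁻ˡ

  ⊢'-theorem : ⊢ a → Γ ⊢' a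
  ⊢'-theorem p = [] , [] , ⊢-by p λ _ h → ⇒⁺ λ _ → h

  ⊢'-by₂ : Γ ⊢' a → Γ ⊢' b → (∀ v → v ⊨ a → v ⊨ b → v ⊨ c) → Γ ⊢' c
  ⊢'-by₂ (L₁ , ps₁ , d₁) (L₂ , ps₂ , d₂) f = L₁ ++ L₂ , ++⁺ ps₁ ps₂ ,
    ⊢-by₂ d₁ d₂ λ v h₁ h₂ → ⇒⁺ λ h → f v (⇒⁻ h₁ (proj₁ (⋀-++ L₁ h))) (⇒⁻ h₂ (proj₂ (⋀-++ L₁ h)))

  ⊢'-mp : Γ ⊢' a → ⊢ (a ⇒ b) → Γ ⊢' b
  ⊢'-mp d p = ⊢'-by₂ d (⊢'-theorem p) λ _ → flip ⇒⁻

  ⊢'-by : Γ ⊢' a → (∀ v → v ⊨ a → v ⊨ b) → Γ ⊢' b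
  ⊢'-by d f = ⊢'-mp d (⊢-taut λ v → ⇒⁺ (f v))

  ⊢'-contradiction : Γ ⊢' a → Γ ⊢' (¬' a) → Γ ⊢' ⊥'
  ⊢'-contradiction d d' = ⊢'-by₂ d d' λ _ h h¬ → ⊥-elim (¬⁻ h¬ h)

  discharge : ∀ {L} → All (Γ ∪ ｛ a ｝) L →
              Σ[ L' ∈ List Form ] All Γ L' × (∀ v → v ⊨ ⋀ L' → v ⊨ a → v ⊨ ⋀ L)
  discharge [] = [] , [] , λ _ _ _ → ⊤⁺
  discharge (inj₁ γ ∷ ps) with discharge ps
  ... | L' , ps' , ent = _ ∷ L' , γ ∷ ps' , λ v h ha → ∧⁺ (∧⁻ˡ h) (ent v (∧⁻ʳ h) ha)
  discharge (inj₂ refl ∷ ps) with discharge ps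
  ... | L' , ps' , ent = L' , ps' , λ v h ha → ∧⁺ ha (ent v h ha)

  ⊢'-deduction : (Γ ∪ ｛ a ｝) ⊢' b → Γ ⊢' (a ⇒ b)
  ⊢'-deduction (_ , ps , d) with discharge ps
  ... | L' , ps' , ent = L' , ps' , ⊢-by d λ v h → ⇒⁺ λ h' → ⇒⁺ λ ha → ⇒⁻ h (ent v h' ha)

  module MaxConsistent (mc : MaxConsistentIn Φ Γ) where

    ⊆Φ : Γ ⊆ Φ
    ⊆Φ = proj₁ (proj₁ mc)

    refutes : Γ ⊢' a → ¬ Γ ⊢' (¬' a)
    refutes d d' = proj₂ (proj₁ mc) (⊢'-contradiction d d')

    ∈-if-⊬¬ : Φ a → ¬ Γ ⊢' (¬' a) → Γ a
    ∈-if-⊬¬ {a} Φa ⊬¬a = proj₂ mc (Γ ∪ ｛ a ｝) inj₁ (extension⊆Φ , extension-consistent) (inj₂ refl)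
      where
      extension⊆Φ : Γ ∪ ｛ a ｝ ⊆ Φ
      extension⊆Φ (inj₁ γ) = ⊆Φ γ
      extension⊆Φ (inj₂ refl) = Φa

      extension-consistent : ¬ (Γ ∪ ｛ a ｝) ⊢' ⊥'
      extension-consistent d = ⊬¬a (⊢'-by (⊢'-deduction d) λ _ h → ¬⁺ (⊥⁻ ∘ ⇒⁻ h))

    ∈-if-⊢ : Φ a → Γ ⊢' a → Γ a
    ∈-if-⊢ Φa d = ∈-if-⊬¬ Φa (refutes d)

    ∈-mp : Γ a → ⊢ (a ⇒ b) → Φ b → Γ b
    ∈-mp γ p Φb = ∈-if-⊢ Φb (⊢'-mp (⊢'-∈ γ) p)

    ∉-if-¬∈ : Γ (¬' a) → ¬ Γ a
    ∉-if-¬∈ γ¬ γ = refutes (⊢'-∈ γ) (⊢'-∈ γ¬)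

    ∈-if-¬∉ : Φ a → Φ (¬' a) → ¬ Γ (¬' a) → Γ a
    ∈-if-¬∉ Φa Φ¬a ∉¬ = ∈-if-⊬¬ Φa (∉¬ ∘ ∈-if-⊢ Φ¬a)

    ¬∈-if-∉ : Φ a → Φ (¬' a) → ¬ Γ a → Γ (¬' a)
    ¬∈-if-∉ Φa Φ¬a ∉ = ∈-if-⊬¬ Φ¬a λ d → ∉ (∈-if-⊢ Φa (⊢'-by d λ _ h → ⊨-stable (¬⁻ h ∘ ¬⁺)))

  erase : Form {n} → Form {n}
  erase (atom p) = atom p
  erase (¬' a) = ¬' erase a
  erase (a ∧' b) = erase a ∧' erase b
  erase (A i a) = ⊤'
  erase (I i a) = erase a
  erase (E i a) = erase a
  erase ([≈] i a) = erase a
  erase ([∘+] i a) = erase a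

  eval-erase : ∀ v a → eval (eval v ∘ erase) a ≡ eval v (erase a)
  eval-erase v (atom p) = refl
  eval-erase v (¬' a) = cong not (eval-erase v a)
  eval-erase v (a ∧' b) = cong₂ _∧_ (eval-erase v a) (eval-erase v b)
  eval-erase v (A i a) = refl
  eval-erase v (I i a) = refl
  eval-erase v (E i a) = refl
  eval-erase v ([≈] i a) = refl
  eval-erase v ([∘+] i a) = refl

  erase-sound : ⊢ a → ∀ v → v ⊨ erase a
  erase-sound (ax (taut {a} t)) v = ⟨ subst T (eval-erase v a) (from T-≡ (t (eval v ∘ erase))) ⟩
  erase-sound (ax A¬) _ = ∧⁺ (⇒⁺ id) (⇒⁺ id)
  erase-sound (ax A∧) _ = ∧⁺ (⇒⁺ λ h → ∧⁺ h h) (⇒⁺ ∧⁻ˡ)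
  erase-sound (ax AA) _ = ∧⁺ (⇒⁺ id) (⇒⁺ id)
  erase-sound (ax AI) _ = ∧⁺ (⇒⁺ id) (⇒⁺ id)
  erase-sound (ax A≈) _ = ∧⁺ (⇒⁺ id) (⇒⁺ id)
  erase-sound (ax A∘) _ = ∧⁺ (⇒⁺ id) (⇒⁺ id)
  erase-sound (ax AE) _ = ∧⁺ (⇒⁺ id) (⇒⁺ id)
  erase-sound (ax A-intro) _ = ⇒⁺ id
  erase-sound (ax ¬A-intro) _ = ⇒⁺ id
  erase-sound (ax A≈p) _ = ⇒⁺ ∧⁻ʳ
  erase-sound (ax KI) _ = ⇒⁺ id
  erase-sound (ax TI) _ = ⇒⁺ id
  erase-sound (ax 5I) _ = ⇒⁺ id
  erase-sound (ax K≈) _ = ⇒⁺ id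
  erase-sound (ax T≈) _ = ⇒⁺ id
  erase-sound (ax 5≈) _ = ⇒⁺ id
  erase-sound (ax K∘) _ = ⇒⁺ id
  erase-sound (ax Mix∘) _ = ⇒⁺ λ h → ∧⁺ h h
  erase-sound (ax Ind∘) _ = ⇒⁺ id
  erase-sound (ax Edef) _ = ∧⁺ (⇒⁺ (∧⁺ ⊤⁺)) (⇒⁺ ∧⁻ʳ)
  erase-sound (mp p q) v = ⇒⁻ (erase-sound p v) (erase-sound q v)
  erase-sound (nec-I p) = erase-sound p
  erase-sound (nec-≈ p) = erase-sound p
  erase-sound (nec-∘ p) = erase-sound p

  isNeg? : Decidable (IsNeg {n})
  isNeg? (atom p) = no λ { (_ , ()) }
  isNeg? (¬' a) = yes (a , refl)
  isNeg? (a ∧' b) = no λ { (_ , ()) }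
  isNeg? (A i a) = no λ { (_ , ()) }
  isNeg? (I i a) = no λ { (_ , ()) }
  isNeg? (E i a) = no λ { (_ , ()) }
  isNeg? ([≈] i a) = no λ { (_ , ()) }
  isNeg? ([∘+] i a) = no λ { (_ , ()) }

  erasure-maxConsistent : (∀ {a} → Φ (¬' a) → Φ a) → (∀ {a} → Φ a → ¬ IsNeg a → Φ (¬' a)) →
                          ∀ v → MaxConsistentIn Φ (Φ ∩ λ a → v ⊨ erase a)
  erasure-maxConsistent {Φ} Φ-¬⁻ Φ-¬⁺ v = (proj₁ , consistent) , maximal
    where
    Γ₀ : Pred Form 0ℓ
    Γ₀ = Φ ∩ λ a → v ⊨ erase a

    ⋀⁺ : ∀ {L} → All Γ₀ L → v ⊨ erase (⋀ L)
    ⋀⁺ [] = ⊤⁺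
    ⋀⁺ ((_ , h) ∷ hs) = ∧⁺ h (⋀⁺ hs)

    consistent : ¬ Γ₀ ⊢' ⊥'
    consistent (_ , ps , d) = ⊥⁻ (⇒⁻ (erase-sound d v) (⋀⁺ ps))

    maximal : ∀ Γ → Γ₀ ⊆ Γ → ConsistentIn Φ Γ → Γ ⊆ Γ₀
    maximal Γ Γ₀⊆Γ (Γ⊆Φ , Γ-consistent) {a} γ = Γ⊆Φ γ , ⊨-stable (refute (isNeg? a))
      where
      refute : Dec (IsNeg a) → ¬ ¬ v ⊨ erase a
      refute (yes (_ , refl)) ⊭a = Γ-consistent (⊢'-contradiction
        (⊢'-∈ (Γ₀⊆Γ (Φ-¬⁻ (Γ⊆Φ γ) , ⊨-stable (⊭a ∘ ¬⁺)))) (⊢'-∈ γ))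
      refute (no ¬neg) ⊭a = Γ-consistent (⊢'-contradiction
        (⊢'-∈ γ) (⊢'-∈ (Γ₀⊆Γ (Φ-¬⁺ (Γ⊆Φ γ) ¬neg , ¬⁺ ⊭a))))

  data IShape (i : Agent {n}) : Form {n} → Set where
    I-shaped  : ∀ θ → IShape i (I i θ)
    ¬I-shaped : ∀ θ → IShape i (¬' I i θ)
    neither   : ¬ OfForm (I i) a → IShape i a

  iShape : ∀ i a → IShape i a
  iShape i (atom p) = neither λ { (_ , inj₁ ()) ; (_ , inj₂ ()) }
  iShape i (a ∧' b) = neither λ { (_ , inj₁ ()) ; (_ , inj₂ ()) }
  iShape i (A j a) = neither λ { (_ , inj₁ ()) ; (_ , inj₂ ()) }
  iShape i (I j a) with j ≟ i
  ... | yes refl = I-shaped a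
  ... | no j≢i = neither λ { (_ , inj₁ refl) → j≢i refl ; (_ , inj₂ ()) }
  iShape i (E j a) = neither λ { (_ , inj₁ ()) ; (_ , inj₂ ()) }
  iShape i ([≈] j a) = neither λ { (_ , inj₁ ()) ; (_ , inj₂ ()) }
  iShape i ([∘+] j a) = neither λ { (_ , inj₁ ()) ; (_ , inj₂ ()) }
  iShape i (¬' atom p) = neither λ { (_ , inj₁ ()) ; (_ , inj₂ ()) }
  iShape i (¬' ¬' a) = neither λ { (_ , inj₁ ()) ; (_ , inj₂ ()) }
  iShape i (¬' (a ∧' b)) = neither λ { (_ , inj₁ ()) ; (_ , inj₂ ()) }
  iShape i (¬' A j a) = neither λ { (_ , inj₁ ()) ; (_ , inj₂ ()) }
  iShape i (¬' I j a) with j ≟ i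
  ... | yes refl = ¬I-shaped a
  ... | no j≢i = neither λ { (_ , inj₁ ()) ; (_ , inj₂ refl) → j≢i refl }
  iShape i (¬' E j a) = neither λ { (_ , inj₁ ()) ; (_ , inj₂ ()) }
  iShape i (¬' [≈] j a) = neither λ { (_ , inj₁ ()) ; (_ , inj₂ ()) }
  iShape i (¬' [∘+] j a) = neither λ { (_ , inj₁ ()) ; (_ , inj₂ ()) }

  module Canonical (φ : Form {n}) where

    Cl-I⁻ : Cl φ (I i a) → Cl φ a
    Cl-I⁻ h = c2 h (I-s here)

    Cl-¬⁻ : Cl φ (¬' a) → Cl φ a
    Cl-¬⁻ h = c2 h (¬-s here)

    module _ {i : Agent {n}} {Γ Δ : Pred Form 0ℓ}
             (mΓ : MaxConsistentIn (Cl φ) Γ) (mΔ : MaxConsistentIn (Cl φ) Δ)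
             (Γ∼Δ : ∀ a → Γ (I i a) → Δ a) where
      private
        module Γ = MaxConsistent mΓ
        module Δ = MaxConsistent mΔ

      I-transfer : Cl φ (I i a) → Γ (I i a) → Δ (I i a)
      I-transfer {a} ΦIa γ with iShape i a
      ... | I-shaped _ = Δ.∈-mp (Γ∼Δ _ γ) ⊢I⇒II ΦIa
      ... | ¬I-shaped _ = Δ.∈-mp (Γ∼Δ _ γ) (ax 5I) ΦIa
      ... | neither ¬IShaped = Γ∼Δ _ (Γ.∈-mp γ ⊢I⇒II (c6a ΦIa ¬IShaped))

      I-reflect : Cl φ (I i a) → Δ (I i a) → Γ (I i a)
      I-reflect {a} ΦIa δ with iShape i a
      ... | I-shaped _ = Γ.∈-mp (I-reflect (Cl-I⁻ ΦIa) (Δ.∈-mp δ (ax TI) (Cl-I⁻ ΦIa))) ⊢I⇒II ΦIa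
      ... | ¬I-shaped θ = Γ.∈-mp Γ¬Iθ (ax 5I) ΦIa
        where
        Φ¬Iθ : Cl φ (¬' I i θ)
        Φ¬Iθ = Cl-I⁻ ΦIa
        ΦIθ : Cl φ (I i θ)
        ΦIθ = Cl-¬⁻ Φ¬Iθ

        Γ¬Iθ : Γ (¬' I i θ)
        Γ¬Iθ = Γ.¬∈-if-∉ ΦIθ Φ¬Iθ (Δ.∉-if-¬∈ (Δ.∈-mp δ (ax TI) Φ¬Iθ) ∘ I-transfer ΦIθ)
      ... | neither ¬IShaped = Γ.∈-if-¬∉ ΦIa (c3 ΦIa λ { (_ , ()) }) λ γ¬ →
        Δ.∉-if-¬∈ (Γ∼Δ _ (Γ.∈-mp γ¬ (ax 5I) (c6b ΦIa ¬IShaped))) δ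

    ∼*-refl : ∀ {w} → ∼* (Cl φ) i w w
    ∼*-refl {w = _ , mΓ} _ γ = ∈-mp γ (ax TI) (Cl-I⁻ (⊆Φ γ))
      where open MaxConsistent mΓ

    ∼*-sym : ∀ {w u} → ∼* (Cl φ) i w u → ∼* (Cl φ) i u w
    ∼*-sym {w = w@(_ , mΓ)} {_ , mΔ} w∼u _ δ =
      ∼*-refl {w = w} _ (I-reflect mΓ mΔ w∼u (MaxConsistent.⊆Φ mΔ δ) δ)

    ∼*-trans : ∀ {w u x} → ∼* (Cl φ) i w u → ∼* (Cl φ) i u x → ∼* (Cl φ) i w x
    ∼*-trans {w = _ , mΓ} {_ , mΔ} w∼u u∼x _ γ =
      u∼x _ (I-transfer mΓ mΔ w∼u (MaxConsistent.⊆Φ mΓ γ) γ)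

    ∼*-isEquivalence : IsEquivalence (∼* (Cl φ) i)
    ∼*-isEquivalence = record
      { refl  = λ {w} → ∼*-refl {w = w}
      ; sym   = λ {w u} → ∼*-sym {w = w} {u}
      ; trans = λ {w u x} → ∼*-trans {w = w} {u} {x}
      }

    𝒜*-preserved : ∀ {w u} → ∼* (Cl φ) i w u → 𝒜* (Cl φ) i w ⊆ 𝒜* (Cl φ) i u
    𝒜*-preserved {w = _ , mΓ} w∼u γ = w∼u _ (∈-mp γ (ax A-intro) (c5a (⊆Φ γ)))
      where open MaxConsistent mΓ

    𝒜*-invariant : ∀ {w u} → ∼* (Cl φ) i w u → ∀ p →
                   (𝒜* (Cl φ) i w p → 𝒜* (Cl φ) i u p) × (𝒜* (Cl φ) i u p → 𝒜* (Cl φ) i w p)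
    𝒜*-invariant {w = w} {u} w∼u _ =
      𝒜*-preserved {w = w} {u} w∼u , 𝒜*-preserved {w = u} {w} (∼*-sym {w = w} {u} w∼u)

lemma7 : ∀ {n : ℕ} (φ : Form {n}) →
    IsEpistemicModelWithAwareness (W* (Cl φ)) (∼* (Cl φ)) (𝒜* (Cl φ)) (V* (Cl φ))
lemma7 φ = record
  { nonempty = _ , erasure-maxConsistent Cl-¬⁻ c3 (λ _ → false)
  ; equiv    = λ _ → ∼*-isEquivalence
  ; aw-inv   = λ _ {w u} → 𝒜*-invariant {w = w} {u}
  }
  where open Canonical φ
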